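{- There is a Katětov functor $F\colon\mathrm{Ult}_{\mathrm{fin}}\to\mathrm{Ult}_{\mathrm{fin}}$.
   Context: $\mathrm{Ult}_{\mathrm{fin}}$ is the category whose objects are finite two-sorted ultrametric spaces $(X,d_X,D_X)$ ($X$ finite, $D_X$ a finite linear order with least element $0$, $d_X$ a $D_X$-valued ultrametric) and whose morphisms are dc-embeddings (an injective $f\colon X\to Y$ together with an order embedding $D_f\colon D_X\to D_Y$ preserving $0$ such that $d_Y(f(x),f(x'))=D_f(d_X(x,x'))$). A one-point extension is a dc-embedding $f\colon X\to Y$ that either is bijective on points and adds exactly one new distance ($|D_Y\setminus D_f[D_X]|=1$), or is bijective on distances and adds exactly one new point. A Katětov functor is a functor $F\colon\mathrm{Ult}_{\mathrm{fin}}\to\mathrm{Ult}_{\mathrm{fin}}$ together with a natural transformation $\eta\colon\mathrm{id}\to F$ such that for every object $X$ and every one-point extension $f\colon X\to Y$ there is a morphism $g\colon Y\to F(X)$ with $g\circ f=\eta_X$. -}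

module Defs where

open import Level using (0ℓ)
open import Data.Nat using (ℕ)
open import Data.Fin using (Fin)
open import Data.Product using (Σ; ∃; _×_; _,_)
open import Data.Sum using (_⊎_)
open import Relation.Nullary using (¬_)
open import Relation.Binary.PropositionalEquality using (_≡_)
open import Relation.Binary.Structures using (IsDecTotalOrder)
open import Function.Bundles using (_↔_)
open import Function.Definitions using (Injective; Surjective)

IsFinite : Set → Set
IsFinite A = Σ ℕ λ n → A ↔ Fin n

record FinLinOrd : Set₁ where
  field
    Carrier        : Set
    _≤_            : Carrier → Carrier → Set
    isDecTotalOrder : IsDecTotalOrder _≡_ _≤_
    finite         : IsFinite Carrier
    𝟘              : Carrier
    𝟘-least        : ∀ d → 𝟘 ≤ d

-- Objects of Ult_fin: finite two-sorted ultrametric spaces (X, d_X, D_X).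

record UltSpace : Set₁ where
  field
    Pt     : Set
    finPt  : IsFinite Pt
    D      : FinLinOrd
  open FinLinOrd D public using () renaming (Carrier to Dist; _≤_ to _≤D_; 𝟘 to 0D)
  field
    d          : Pt → Pt → Dist
    d-zero     : ∀ x y → d x y ≡ 0D → x ≡ y
    d-refl     : ∀ x → d x x ≡ 0D
    d-sym      : ∀ x y → d x y ≡ d y x
    d-ultra    : ∀ x y z → (d x z ≤D d x y) ⊎ (d x z ≤D d y z)

open UltSpace

record DcEmb (X Y : UltSpace) : Set where
  field
    f       : Pt X → Pt Y
    f-inj   : Injective _≡_ _≡_ f
    Df      : Dist X → Dist Y
    Df-mono : ∀ a b → _≤D_ X a b → _≤D_ Y (Df a) (Df b)
    Df-refl : ∀ a b → _≤D_ Y (Df a) (Df b) → _≤D_ X a b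
    Df-inj  : Injective _≡_ _≡_ Df
    Df-0    : Df (0D X) ≡ 0D Y
    f-dist  : ∀ x x' → d Y (f x) (f x') ≡ Df (d X x x')

open DcEmb

_≈_ : ∀ {X Y} → DcEmb X Y → DcEmb X Y → Set
g ≈ h = (∀ x → f g x ≡ f h x) × (∀ a → Df g a ≡ Df h a)

idEmb : ∀ X → DcEmb X X
idEmb X = record
  { f = λ x → x ; f-inj = λ p → p ; Df = λ a → a
  ; Df-mono = λ _ _ p → p ; Df-refl = λ _ _ p → p ; Df-inj = λ p → p
  ; Df-0 = Relation.Binary.PropositionalEquality.refl
  ; f-dist = λ _ _ → Relation.Binary.PropositionalEquality.refl }

_∘E_ : ∀ {X Y Z} → DcEmb Y Z → DcEmb X Y → DcEmb X Z
_∘E_ {X} {Y} {Z} g h = record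
  { f = λ x → f g (f h x)
  ; f-inj = λ p → f-inj h (f-inj g p)
  ; Df = λ a → Df g (Df h a)
  ; Df-mono = λ a b p → Df-mono g _ _ (Df-mono h a b p)
  ; Df-refl = λ a b p → Df-refl h a b (Df-refl g _ _ p)
  ; Df-inj = λ p → Df-inj h (Df-inj g p)
  ; Df-0 = Relation.Binary.PropositionalEquality.trans
             (Relation.Binary.PropositionalEquality.cong (Df g) (Df-0 h)) (Df-0 g)
  ; f-dist = λ x x' → Relation.Binary.PropositionalEquality.trans
             (f-dist g (f h x) (f h x'))
             (Relation.Binary.PropositionalEquality.cong (Df g) (f-dist h x x')) }

ExactlyOneNew : {A B : Set} → (A → B) → Set
ExactlyOneNew {A} {B} g =
  Σ B λ b → (¬ (∃ λ a → g a ≡ b)) × (∀ b' → ¬ (∃ λ a → g a ≡ b') → b' ≡ b)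

IsOnePointExt : ∀ {X Y} → DcEmb X Y → Set
IsOnePointExt e =
    (Surjective _≡_ _≡_ (f e) × ExactlyOneNew (Df e))
  ⊎ (Surjective _≡_ _≡_ (Df e) × ExactlyOneNew (f e))

record Endofunctor : Set₁ where
  field
    F₀     : UltSpace → UltSpace
    F₁     : ∀ {X Y} → DcEmb X Y → DcEmb (F₀ X) (F₀ Y)
    F-resp : ∀ {X Y} {g h : DcEmb X Y} → g ≈ h → F₁ g ≈ F₁ h
    F-id   : ∀ {X} → F₁ (idEmb X) ≈ idEmb (F₀ X)
    F-∘    : ∀ {X Y Z} (g : DcEmb Y Z) (h : DcEmb X Y) →
             F₁ (g ∘E h) ≈ (F₁ g ∘E F₁ h)

record KatetovFunctor : Set₁ where
  field
    functor : Endofunctor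
  open Endofunctor functor
  field
    η          : ∀ X → DcEmb X (F₀ X)
    η-natural  : ∀ {X Y} (h : DcEmb X Y) → (F₁ h ∘E η X) ≈ (η Y ∘E h)
    katetov    : ∀ {X Y} (e : DcEmb X Y) → IsOnePointExt e →
                 Σ (DcEmb Y (F₀ X)) λ g → (g ∘E e) ≈ η X

-- F X consists of the points of X × D_X, where (x , r) and (y , s) are at distance
-- max (r , s , d x y) when distinct, together with one extra point ∙ at a new largest
-- distance ∞ from all of them. Its distances are D_X × Bool in lexicographic order, plus ∞,
-- with D_X embedded as (a , false); so (a , true) is a fresh distance right above a.
--
-- A one-point extension adding a distance δ is realised by sending δ to (p , true), for p
-- the largest old distance below δ. One adding a point y₀ at distances k x from the old
-- points sends y₀ to (x₀ , k x₀), where x₀ minimises k: by the strong triangle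
-- inequality max (k x₀ , d x x₀) = k x. If X is empty, y₀ goes to ∙.

module Submission where

open import Level using (0ℓ)
open import Data.Bool using (Bool; true; false; f≤t) renaming (_≤_ to _≤ᴮ_)
import Data.Bool.Properties as Bool
open import Data.Empty using (⊥-elim)
open import Data.Fin using (Fin; zero; suc)
import Data.Fin as Fin
open import Data.Fin.Properties using (2↔Bool; *↔×)
open import Data.List using (List; []; _∷_; map; filter; allFin)
open import Data.List.Membership.Propositional using (_∈_; lose)
open import Data.List.Membership.Propositional.Properties using (∈-map⁺; ∈-allFin; ∈-filter⁺)
open import Data.List.Relation.Unary.All using (lookup)
open import Data.List.Relation.Unary.All.Properties using (all-filter)
open import Data.List.Relation.Unary.Any using (here; there; satisfied; any?)
import Data.List.Extrema as Extrema
open import Data.Nat as ℕ using (_*_)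
open import Data.Product using (Σ; ∃; _×_; _,_; proj₁; proj₂)
import Data.Product as Product
import Data.Maybe as Maybe
import Data.Maybe.Properties as Maybe
open import Data.Product.Function.NonDependent.Propositional using (_×-↔_)
open import Data.Product.Properties using (≡-dec)
open import Data.Product.Relation.Binary.Lex.NonStrict using (×-Lex; ×-isDecTotalOrder)
open import Data.Product.Relation.Binary.Pointwise.NonDependent using (≡×≡⇒≡; ≡⇒≡×≡)
open import Data.Sum using (_⊎_; inj₁; inj₂)
import Data.Sum as Sum
open import Function using (_∘_; id)
open import Function.Bundles using (Inverse; mk↔ₛ′)
open import Function.Definitions using (Injective; Surjective)
open import Function.Properties.Inverse using (↔-trans; ↔-sym; ↔⇒↣)
open import Relation.Binary.Bundles using (TotalOrder)
open import Relation.Binary.Core using (Rel; _⇔_)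
open import Relation.Binary.Definitions using (DecidableEquality)
open import Relation.Binary.PropositionalEquality
open import Relation.Binary.Structures using (IsDecTotalOrder)
open import Relation.Nullary using (¬_; Dec; yes; no)
open import Relation.Nullary.Decidable using (map′; via-injection)
open import Relation.Nullary.Construct.Add.Point using (Pointed; ∙; [_])
open import Relation.Nullary.Construct.Add.Supremum using (_⁺; ⊤⁺)
open import Relation.Unary using (Pred; Decidable)
import Algebra.Construct.NaturalChoice.Max as Max
import Relation.Binary.Construct.Add.Supremum.NonStrict as Supremum
import Relation.Binary.Reasoning.PartialOrder as PosetReasoning

open import Defs

open UltSpace
open DcEmb

private
  variable
    A B : Set

isFinite-Bool : IsFinite Bool
isFinite-Bool = 2 , ↔-sym 2↔Bool

isFinite-× : IsFinite A → IsFinite B → IsFinite (A × B)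
isFinite-× (m , A↔) (n , B↔) = m * n , ↔-trans (A↔ ×-↔ B↔) (↔-sym *↔×)

isFinite-Pointed : IsFinite A → IsFinite (Pointed A)
isFinite-Pointed (n , A↔) = ℕ.suc n , mk↔ₛ′ to′ from′ to∘from from∘to
  where
    open Inverse A↔
    to′ : Pointed _ → Fin _
    to′ ∙     = zero
    to′ [ x ] = suc (to x)
    from′ : Fin _ → Pointed _
    from′ zero    = ∙
    from′ (suc i) = [ from i ]
    to∘from : ∀ i → to′ (from′ i) ≡ i
    to∘from zero    = refl
    to∘from (suc i) = cong suc (strictlyInverseˡ i)
    from∘to : ∀ x → from′ (to′ x) ≡ x
    from∘to ∙     = refl
    from∘to [ x ] = cong [_] (strictlyInverseʳ x)

module Finite (fin : IsFinite A) where
  private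
    open Inverse (proj₂ fin)

  enumerate : List A
  enumerate = map from (allFin (proj₁ fin))

  ∈-enumerate : ∀ x → x ∈ enumerate
  ∈-enumerate x = subst (_∈ enumerate) (strictlyInverseʳ x) (∈-map⁺ from (∈-allFin (to x)))

  _≟_ : DecidableEquality A
  _≟_ = via-injection (↔⇒↣ (proj₂ fin)) Fin._≟_

  ∃? : {P : Pred A 0ℓ} → Decidable P → Dec (∃ P)
  ∃? P? = map′ satisfied (λ (x , px) → lose (∈-enumerate x) px) (any? P? enumerate)

  image-or-new : {g : A → B} → DecidableEquality B → (new : ExactlyOneNew g) →
                 ∀ b → (∃ λ a → g a ≡ b) ⊎ b ≡ proj₁ new
  image-or-new {g = g} _≟B_ (_ , _ , unique) b with ∃? (λ a → g a ≟B b)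
  ... | yes old = inj₁ old
  ... | no ¬old = inj₂ (unique b ¬old)

module LinOrd (L : FinLinOrd) where
  open FinLinOrd L public hiding (_≤_)

  infix 4 _≤_
  _≤_ : Rel Carrier 0ℓ
  _≤_ = FinLinOrd._≤_ L
  open IsDecTotalOrder isDecTotalOrder public
    using (antisym; total; _≟_; _≤?_; isTotalOrder)
    renaming (refl to ≤-refl; trans to ≤-trans; reflexive to ≤-reflexive)

  totalOrder : TotalOrder 0ℓ 0ℓ 0ℓ
  totalOrder = record { isTotalOrder = isTotalOrder }

  open Max totalOrder public
    using (_⊔_; x≤x⊔y; x≤y⊔x; ⊔-lub; ⊔-sel; ⊔-comm; ⊔-mono-≤; x≤y⇒x⊔y≈y; x≤y⇒y⊔x≈y)
  open Extrema totalOrder public using (argmin)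
  open Extrema totalOrder using (argmax; argmax-all; f[xs]≤f[argmax]; f[argmin]≤v⁺)
  module ≤-Reasoning = PosetReasoning (TotalOrder.poset totalOrder)

  ≤𝟘⇒≡𝟘 : ∀ {a} → a ≤ 𝟘 → a ≡ 𝟘
  ≤𝟘⇒≡𝟘 a≤𝟘 = antisym a≤𝟘 (𝟘-least _)

  𝟘⊔a≡a : ∀ a → 𝟘 ⊔ a ≡ a
  𝟘⊔a≡a a = x≤y⇒x⊔y≈y (𝟘-least a)

  ≤⊔⇒≤⊎≤ : ∀ {c} a b → c ≤ a ⊔ b → c ≤ a ⊎ c ≤ b
  ≤⊔⇒≤⊎≤ {c} a b c≤a⊔b with ⊔-sel a b
  ... | inj₁ a⊔b≡a = inj₁ (subst (c ≤_) a⊔b≡a c≤a⊔b)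
  ... | inj₂ a⊔b≡b = inj₂ (subst (c ≤_) a⊔b≡b c≤a⊔b)

  ⊔≡𝟘 : ∀ {a b} → a ⊔ b ≡ 𝟘 → a ≡ 𝟘 × b ≡ 𝟘
  ⊔≡𝟘 {a} {b} a⊔b≡𝟘 =
    ≤𝟘⇒≡𝟘 (subst (a ≤_) a⊔b≡𝟘 (x≤x⊔y a b)) , ≤𝟘⇒≡𝟘 (subst (b ≤_) a⊔b≡𝟘 (x≤y⊔x a b))

  argmin-minimal : (f : A → Carrier) → ∀ {x ⊤ xs} → x ∈ ⊤ ∷ xs → f (argmin f ⊤ xs) ≤ f x
  argmin-minimal f {xs = xs} (here refl)  = f[argmin]≤v⁺ {f = f} _ xs (inj₁ ≤-refl)
  argmin-minimal f {⊤ = ⊤} (there x∈xs) = f[argmin]≤v⁺ {f = f} ⊤ _ (inj₂ (lose x∈xs ≤-refl))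

  greatest : {P : Pred Carrier 0ℓ} → Decidable P → ∀ {a} → P a →
             Σ Carrier λ p → P p × (∀ b → P b → b ≤ p)
  greatest P? {a} Pa =
    argmax id a candidates ,
    argmax-all id Pa (all-filter P? enumerate) ,
    λ b Pb → lookup (f[xs]≤f[argmax] a candidates) (∈-filter⁺ P? (∈-enumerate b) Pb)
    where
      open Finite finite
      candidates = filter P? enumerate

module _ {L M : FinLinOrd} {h : FinLinOrd.Carrier L → FinLinOrd.Carrier M} where
  private
    module L = LinOrd L
    module M = LinOrd M

  mono⇒distrib-⊔ : (∀ a b → a L.≤ b → h a M.≤ h b) → ∀ a b → h (a L.⊔ b) ≡ h a M.⊔ h b
  mono⇒distrib-⊔ mono a b with L.total a b
  ... | inj₁ a≤b = trans (cong h (L.x≤y⇒x⊔y≈y a≤b)) (sym (M.x≤y⇒x⊔y≈y (mono a b a≤b)))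
  ... | inj₂ b≤a = trans (cong h (L.x≤y⇒y⊔x≈y b≤a)) (sym (M.x≤y⇒y⊔x≈y (mono b a b≤a)))

  mono∧injective⇒reflects : (∀ a b → a L.≤ b → h a M.≤ h b) → Injective _≡_ _≡_ h →
                            ∀ a b → h a M.≤ h b → a L.≤ b
  mono∧injective⇒reflects mono inj a b ha≤hb with L.total a b
  ... | inj₁ a≤b = a≤b
  ... | inj₂ b≤a = L.≤-reflexive (inj (M.antisym ha≤hb (mono b a b≤a)))

mkDcEmb : ∀ {X Y} (f : Pt X → Pt Y) (Df : Dist X → Dist Y) →
          (∀ a b → _≤D_ X a b → _≤D_ Y (Df a) (Df b)) → Injective _≡_ _≡_ Df →
          Df (0D X) ≡ 0D Y → (∀ x x' → d Y (f x) (f x') ≡ Df (d X x x')) → DcEmb X Y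
mkDcEmb {X} {Y} f Df mono inj Df-0 f-dist = record
  { f = f ; f-inj = f-injective ; Df = Df ; Df-mono = mono
  ; Df-refl = mono∧injective⇒reflects {D X} {D Y} mono inj ; Df-inj = inj
  ; Df-0 = Df-0 ; f-dist = f-dist }
  where
    open ≡-Reasoning
    f-injective : Injective _≡_ _≡_ f
    f-injective {x} {x'} fx≡fx' = d-zero X x x' (inj (begin
      Df (d X x x')    ≡⟨ f-dist x x' ⟨
      d Y (f x) (f x') ≡⟨ cong (d Y (f x)) fx≡fx' ⟨
      d Y (f x) (f x)  ≡⟨ d-refl Y (f x) ⟩
      0D Y             ≡⟨ Df-0 ⟨
      Df (0D X)        ∎))

isDecTotalOrder-≡ : {_≈_ _≤_ : Rel A 0ℓ} → _≈_ ⇔ _≡_ →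
                    IsDecTotalOrder _≈_ _≤_ → IsDecTotalOrder _≡_ _≤_
isDecTotalOrder-≡ (≈⇒≡ , ≡⇒≈) O = record
  { isTotalOrder = record
    { isPartialOrder = record
      { isPreorder = record
        { isEquivalence = isEquivalence ; reflexive = O.reflexive ∘ ≡⇒≈ ; trans = O.trans }
      ; antisym = λ x≤y y≤x → ≈⇒≡ (O.antisym x≤y y≤x) }
    ; total = O.total }
  ; _≟_ = λ x y → map′ ≈⇒≡ ≡⇒≈ (x O.≟ y)
  ; _≤?_ = O._≤?_ }
  where module O = IsDecTotalOrder O

module Gapped (L : FinLinOrd) where
  open LinOrd L

  _≤ₗ_ : Rel (Carrier × Bool) 0ℓ
  _≤ₗ_ = ×-Lex _≡_ _≤_ _≤ᴮ_

  open Supremum _≤ₗ_ public using (_≤⁺_; [_]; _≤⊤⁺; ≤⁺-isDecTotalOrder-≡)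

  ≤ₗ-mono : ∀ {a a' b b'} → a ≤ a' → b ≤ᴮ b' → (a , b) ≤ₗ (a' , b')
  ≤ₗ-mono {a} {a'} a≤a' b≤b' with a ≟ a'
  ... | yes a≡a' = inj₂ (a≡a' , b≤b')
  ... | no a≢a'  = inj₁ (a≤a' , a≢a')

  ι : Carrier → (Carrier × Bool) ⁺
  ι a = [ a , false ]

  ι-mono : ∀ a b → a ≤ b → ι a ≤⁺ ι b
  ι-mono _ _ a≤b = [ ≤ₗ-mono a≤b Bool.≤-refl ]

  ι-injective : Injective _≡_ _≡_ ι
  ι-injective refl = refl

  ι≢gap : ∀ {a b} → ι a ≢ [ b , true ]
  ι≢gap ()

  linOrd : FinLinOrd
  linOrd = record
    { Carrier = (Carrier × Bool) ⁺
    ; _≤_ = _≤⁺_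
    ; isDecTotalOrder = ≤⁺-isDecTotalOrder-≡ (isDecTotalOrder-≡ (≡×≡⇒≡ , ≡⇒≡×≡)
        (×-isDecTotalOrder isDecTotalOrder Bool.≤-isDecTotalOrder))
    ; finite = isFinite-Pointed (isFinite-× finite isFinite-Bool)
    ; 𝟘 = ι 𝟘
    ; 𝟘-least = λ { ⊤⁺ → _ ≤⊤⁺ ; [ a , b ] → [ ≤ₗ-mono (𝟘-least a) (Bool.≤-minimum b) ] }
    }

module _ (X : UltSpace) where
  open LinOrd (D X)

  d-ultra-⊔ : ∀ x y z → d X x z ≤ d X x y ⊔ d X y z
  d-ultra-⊔ x y z with d-ultra X x y z
  ... | inj₁ ≤dxy = ≤-trans ≤dxy (x≤x⊔y _ _)
  ... | inj₂ ≤dyz = ≤-trans ≤dyz (x≤y⊔x _ _)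

module _ (L : FinLinOrd) where
  open LinOrd L

  module ZeroedDiagonal {P : Set} (_≟ₚ_ : DecidableEquality P) (ρ : P → P → Carrier)
    (ρ-sym : ∀ p q → ρ p q ≡ ρ q p) (ρ-ultra : ∀ p q u → ρ p u ≤ ρ p q ⊔ ρ q u)
    (ρ-zero : ∀ p q → ρ p q ≡ 𝟘 → p ≡ q) where

    δ : P → P → Carrier
    δ p q with p ≟ₚ q
    ... | yes _ = 𝟘
    ... | no _  = ρ p q

    δ≡ρ : ∀ {p q} → (p ≡ q → ρ p q ≡ 𝟘) → δ p q ≡ ρ p q
    δ≡ρ {p} {q} ρ-diagonal with p ≟ₚ q
    ... | yes p≡q = sym (ρ-diagonal p≡q)
    ... | no _    = refl

    δ-≢ : ∀ {p q} → p ≢ q → δ p q ≡ ρ p q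
    δ-≢ p≢q = δ≡ρ (⊥-elim ∘ p≢q)

    δ-refl : ∀ p → δ p p ≡ 𝟘
    δ-refl p with p ≟ₚ p
    ... | yes _  = refl
    ... | no p≢p = ⊥-elim (p≢p refl)

    δ-zero : ∀ p q → δ p q ≡ 𝟘 → p ≡ q
    δ-zero p q δ≡𝟘 with p ≟ₚ q
    ... | yes p≡q = p≡q
    ... | no _    = ρ-zero p q δ≡𝟘

    δ-sym : ∀ p q → δ p q ≡ δ q p
    δ-sym p q with p ≟ₚ q | q ≟ₚ p
    ... | yes _   | yes _   = refl
    ... | yes p≡q | no q≢p  = ⊥-elim (q≢p (sym p≡q))
    ... | no p≢q  | yes q≡p = ⊥-elim (p≢q (sym q≡p))
    ... | no _    | no _    = ρ-sym p q

    δ≤ρ : ∀ p q → δ p q ≤ ρ p q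
    δ≤ρ p q with p ≟ₚ q
    ... | yes _ = 𝟘-least _
    ... | no _  = ≤-refl

    δ-ultra : ∀ p q u → δ p u ≤ δ p q ⊎ δ p u ≤ δ q u
    δ-ultra p q u = by-cases (p ≟ₚ q) (q ≟ₚ u)
      where
        open ≤-Reasoning
        by-cases : Dec (p ≡ q) → Dec (q ≡ u) → δ p u ≤ δ p q ⊎ δ p u ≤ δ q u
        by-cases (yes p≡q) _         = inj₂ (≤-reflexive (cong (λ z → δ z u) p≡q))
        by-cases (no _)    (yes q≡u) = inj₁ (≤-reflexive (cong (δ p) (sym q≡u)))
        by-cases (no p≢q)  (no q≢u)  = ≤⊔⇒≤⊎≤ _ _ (begin
          δ p u         ≤⟨ δ≤ρ p u ⟩
          ρ p u         ≤⟨ ρ-ultra p q u ⟩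
          ρ p q ⊔ ρ q u ≡⟨ cong₂ _⊔_ (δ-≢ p≢q) (δ-≢ q≢u) ⟨
          δ p q ⊔ δ q u ∎)

module Heights (X : UltSpace) where
  open LinOrd (D X)

  _≟ₚ_ : DecidableEquality (Pt X × Dist X)
  _≟ₚ_ = ≡-dec (Finite._≟_ (finPt X)) _≟_

  ρ : Pt X × Dist X → Pt X × Dist X → Dist X
  ρ (x , r) (y , s) = r ⊔ s ⊔ d X x y

  ρ-sym : ∀ p q → ρ p q ≡ ρ q p
  ρ-sym (x , r) (y , s) = cong₂ _⊔_ (⊔-comm r s) (d-sym X x y)

  ρ-ultra : ∀ p q u → ρ p u ≤ ρ p q ⊔ ρ q u
  ρ-ultra (x , r) (y , s) (z , t) = ⊔-lub (⊔-lub r≤ t≤) dxz≤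
    where
      r≤ : r ≤ (r ⊔ s ⊔ d X x y) ⊔ (s ⊔ t ⊔ d X y z)
      r≤ = ≤-trans (x≤x⊔y r s) (≤-trans (x≤x⊔y _ _) (x≤x⊔y _ _))
      t≤ : t ≤ (r ⊔ s ⊔ d X x y) ⊔ (s ⊔ t ⊔ d X y z)
      t≤ = ≤-trans (x≤y⊔x s t) (≤-trans (x≤x⊔y _ _) (x≤y⊔x _ _))
      dxz≤ : d X x z ≤ (r ⊔ s ⊔ d X x y) ⊔ (s ⊔ t ⊔ d X y z)
      dxz≤ = ≤-trans (d-ultra-⊔ X x y z) (⊔-mono-≤ (x≤y⊔x _ _) (x≤y⊔x _ _))

  ρ-zero : ∀ p q → ρ p q ≡ 𝟘 → p ≡ q
  ρ-zero (x , r) (y , s) ρ≡𝟘 =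
    let r⊔s≡𝟘 , dxy≡𝟘 = ⊔≡𝟘 ρ≡𝟘
        r≡𝟘 , s≡𝟘 = ⊔≡𝟘 r⊔s≡𝟘
    in cong₂ _,_ (d-zero X x y dxy≡𝟘) (trans r≡𝟘 (sym s≡𝟘))

  open ZeroedDiagonal (D X) _≟ₚ_ ρ ρ-sym ρ-ultra ρ-zero public

  space : UltSpace
  space = record
    { Pt = Pt X × Dist X ; finPt = isFinite-× (finPt X) finite ; D = D X
    ; d = δ ; d-zero = δ-zero ; d-refl = δ-refl ; d-sym = δ-sym ; d-ultra = δ-ultra }

  ρ-ground : ∀ x y → ρ (x , 𝟘) (y , 𝟘) ≡ d X x y
  ρ-ground x y = trans (cong (_⊔ d X x y) (𝟘⊔a≡a 𝟘)) (𝟘⊔a≡a _)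

  δ-ground : ∀ x y → δ (x , 𝟘) (y , 𝟘) ≡ d X x y
  δ-ground x y = trans (δ≡ρ ρ-diagonal) (ρ-ground x y)
    where
      ρ-diagonal : (x , 𝟘) ≡ (y , 𝟘) → ρ (x , 𝟘) (y , 𝟘) ≡ 𝟘
      ρ-diagonal refl = trans (ρ-ground x x) (d-refl X x)

  ground : DcEmb X space
  ground = mkDcEmb (_, 𝟘) id (λ _ _ → id) id refl δ-ground

module FarPoint (Z : UltSpace) where
  open Gapped (D Z)
  open LinOrd linOrd using (≤-refl; 𝟘-least)

  d∞ : Pointed (Pt Z) → Pointed (Pt Z) → (Dist Z × Bool) ⁺
  d∞ ∙     ∙     = ι (0D Z)
  d∞ ∙     [ _ ] = ⊤⁺
  d∞ [ _ ] ∙     = ⊤⁺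
  d∞ [ p ] [ q ] = ι (d Z p q)

  d∞-zero : ∀ p q → d∞ p q ≡ ι (0D Z) → p ≡ q
  d∞-zero ∙     ∙     _     = refl
  d∞-zero [ p ] [ q ] d≡𝟘 = cong [_] (d-zero Z p q (ι-injective d≡𝟘))

  d∞-refl : ∀ p → d∞ p p ≡ ι (0D Z)
  d∞-refl ∙     = refl
  d∞-refl [ p ] = cong ι (d-refl Z p)

  d∞-sym : ∀ p q → d∞ p q ≡ d∞ q p
  d∞-sym ∙     ∙     = refl
  d∞-sym ∙     [ _ ] = refl
  d∞-sym [ _ ] ∙     = refl
  d∞-sym [ p ] [ q ] = cong ι (d-sym Z p q)

  d∞-ultra : ∀ p q u → d∞ p u ≤⁺ d∞ p q ⊎ d∞ p u ≤⁺ d∞ q u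
  d∞-ultra [ p ] [ q ] [ u ] = Sum.map (ι-mono _ _) (ι-mono _ _) (d-ultra Z p q u)
  d∞-ultra ∙     ∙     u     = inj₂ ≤-refl
  d∞-ultra p     ∙     ∙     = inj₁ ≤-refl
  d∞-ultra ∙     [ _ ] ∙     = inj₁ (𝟘-least _)
  d∞-ultra ∙     [ _ ] [ _ ] = inj₁ ≤-refl
  d∞-ultra [ _ ] ∙     [ _ ] = inj₁ (_ ≤⊤⁺)
  d∞-ultra [ _ ] [ _ ] ∙     = inj₂ ≤-refl

  space : UltSpace
  space = record
    { Pt = Pointed (Pt Z) ; finPt = isFinite-Pointed (finPt Z) ; D = linOrd
    ; d = d∞ ; d-zero = d∞-zero ; d-refl = d∞-refl ; d-sym = d∞-sym ; d-ultra = d∞-ultra }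

  embed : DcEmb Z space
  embed = mkDcEmb [_] ι ι-mono ι-injective refl (λ _ _ → refl)

module _ {X Y : UltSpace} (h : DcEmb X Y) where
  private
    module X = Heights X
    module Y = Heights Y
    module DX = LinOrd (D X)
    module DY = LinOrd (D Y)

  height-map : Pt X × Dist X → Pt Y × Dist Y
  height-map = Product.map (f h) (Df h)

  Heights₁ : DcEmb X.space Y.space
  Heights₁ = mkDcEmb height-map (Df h) (Df-mono h) (Df-inj h) (Df-0 h) δ-natural
    where
      ρ-natural : ∀ p q → Y.ρ (height-map p) (height-map q) ≡ Df h (X.ρ p q)
      ρ-natural (x , r) (y , s) = begin
        Df h r DY.⊔ Df h s DY.⊔ d Y (f h x) (f h y) ≡⟨ cong (_ DY.⊔_) (f-dist h x y) ⟩
        Df h r DY.⊔ Df h s DY.⊔ Df h (d X x y)     ≡⟨ cong (DY._⊔ _) (distrib r s) ⟨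
        Df h (r DX.⊔ s) DY.⊔ Df h (d X x y)       ≡⟨ distrib (r DX.⊔ s) (d X x y) ⟨
        Df h (r DX.⊔ s DX.⊔ d X x y)              ∎
        where
          open ≡-Reasoning
          distrib = mono⇒distrib-⊔ {D X} {D Y} (Df-mono h)

      height-map-injective : Injective _≡_ _≡_ height-map
      height-map-injective eq = cong₂ _,_ (f-inj h (cong proj₁ eq)) (Df-inj h (cong proj₂ eq))

      δ-natural : ∀ p q → Y.δ (height-map p) (height-map q) ≡ Df h (X.δ p q)
      δ-natural p q with p X.≟ₚ q
      ... | yes refl = trans (Y.δ-refl _) (sym (Df-0 h))
      ... | no p≢q   = trans (Y.δ-≢ (p≢q ∘ height-map-injective)) (ρ-natural p q)

module _ {Z W : UltSpace} (h : DcEmb Z W) where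
  private
    module Z = Gapped (D Z)
    module W = Gapped (D W)

  gap-map : (Dist Z × Bool) ⁺ → (Dist W × Bool) ⁺
  gap-map = Maybe.map (Product.map₁ (Df h))

  FarPoint₁ : DcEmb (FarPoint.space Z) (FarPoint.space W)
  FarPoint₁ = mkDcEmb (Maybe.map (f h)) gap-map mono injective (cong W.ι (Df-0 h)) f∞-dist
    where
      mono : ∀ a b → a Z.≤⁺ b → gap-map a W.≤⁺ gap-map b
      mono _ _ Z.[ inj₁ (a≤a' , a≢a') ] = W.[ inj₁ (Df-mono h _ _ a≤a' , a≢a' ∘ Df-inj h) ]
      mono _ _ Z.[ inj₂ (refl , b≤b') ] = W.[ inj₂ (refl , b≤b') ]
      mono _ _ (_ Z.≤⊤⁺)                = _ W.≤⊤⁺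

      injective : Injective _≡_ _≡_ gap-map
      injective = Maybe.map-injective (λ eq → cong₂ _,_ (Df-inj h (cong proj₁ eq)) (cong proj₂ eq))

      f∞-dist : ∀ p q → FarPoint.d∞ W (Maybe.map (f h) p) (Maybe.map (f h) q)
                      ≡ gap-map (FarPoint.d∞ Z p q)
      f∞-dist ∙     ∙     = cong W.ι (sym (Df-0 h))
      f∞-dist ∙     [ _ ] = refl
      f∞-dist [ _ ] ∙     = refl
      f∞-dist [ p ] [ q ] = cong W.ι (f-dist h p q)

F₀ : UltSpace → UltSpace
F₀ X = FarPoint.space (Heights.space X)

F₁ : ∀ {X Y} → DcEmb X Y → DcEmb (F₀ X) (F₀ Y)
F₁ h = FarPoint₁ (Heights₁ h)

η : ∀ X → DcEmb X (F₀ X)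
η X = FarPoint.embed (Heights.space X) ∘E Heights.ground X

functor : Endofunctor
functor = record
  { F₀ = F₀
  ; F₁ = F₁
  ; F-resp = λ (f≗ , Df≗) →
      (λ { ∙ → refl ; [ x , r ] → cong₂ (λ x r → [ x , r ]) (f≗ x) (Df≗ r) }) ,
      (λ { ⊤⁺ → refl ; [ a , b ] → cong (λ a → [ a , b ]) (Df≗ a) })
  ; F-id = (λ { ∙ → refl ; [ _ ] → refl }) , (λ { ⊤⁺ → refl ; [ _ ] → refl })
  ; F-∘ = λ _ _ → (λ { ∙ → refl ; [ _ ] → refl }) , (λ { ⊤⁺ → refl ; [ _ ] → refl })
  }

η-natural : ∀ {X Y} (h : DcEmb X Y) → (F₁ h ∘E η X) ≈ (η Y ∘E h)
η-natural h = (λ x → cong (λ r → [ f h x , r ]) (Df-0 h)) , (λ _ → refl)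

module NewDistance {X Y : UltSpace} (e : DcEmb X Y)
  (onto-points : Surjective _≡_ _≡_ (f e)) (new : ExactlyOneNew (Df e)) where
  private
    module DX = LinOrd (D X)
    module DY = LinOrd (D Y)
    open Gapped (D X)
    open LinOrd linOrd using (≤-refl)

    δ : Dist Y
    δ = proj₁ new

    δ-new : ¬ ∃ λ a → Df e a ≡ δ
    δ-new = proj₁ (proj₂ new)

  preimage : Pt Y → Pt X
  preimage y = proj₁ (onto-points y)

  f∘preimage : ∀ y → f e (preimage y) ≡ y
  f∘preimage y = proj₂ (onto-points y) refl

  private
    below-δ : Σ (Dist X) λ p → Df e p DY.≤ δ × ∀ a → Df e a DY.≤ δ → a DX.≤ p
    below-δ = DX.greatest (λ a → Df e a DY.≤? δ) {DX.𝟘}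
                          (subst (DY._≤ δ) (sym (Df-0 e)) (DY.𝟘-least δ))

  p : Dist X
  p = proj₁ below-δ

  Df-p≤δ : Df e p DY.≤ δ
  Df-p≤δ = proj₁ (proj₂ below-δ)

  p-greatest : ∀ a → Df e a DY.≤ δ → a DX.≤ p
  p-greatest = proj₂ (proj₂ below-δ)

  classify : ∀ c → (∃ λ a → Df e a ≡ c) ⊎ c ≡ δ
  classify = Finite.image-or-new DX.finite DY._≟_ new

  Dg : Dist Y → Dist (F₀ X)
  Dg c with classify c
  ... | inj₁ (a , _) = ι a
  ... | inj₂ _       = [ p , true ]

  Dg-Df : ∀ a → Dg (Df e a) ≡ ι a
  Dg-Df a with classify (Df e a)
  ... | inj₁ (_ , Df≡Df) = cong ι (Df-inj e Df≡Df)
  ... | inj₂ Df≡δ        = ⊥-elim (δ-new (a , Df≡δ))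

  Dg-mono : ∀ c c' → c DY.≤ c' → Dg c ≤⁺ Dg c'
  Dg-mono c c' c≤c' with classify c | classify c'
  ... | inj₁ (_ , refl) | inj₁ (_ , refl) = ι-mono _ _ (Df-refl e _ _ c≤c')
  ... | inj₁ (a , refl) | inj₂ refl       = [ ≤ₗ-mono (p-greatest a c≤c') f≤t ]
  ... | inj₂ refl       | inj₁ (a , refl) = [ inj₁ (p≤a , p≢a) ]
    where
      p≤a : p DX.≤ a
      p≤a = Df-refl e p a (DY.≤-trans Df-p≤δ c≤c')
      p≢a : p ≢ a
      p≢a refl = δ-new (p , DY.antisym Df-p≤δ c≤c')
  ... | inj₂ refl       | inj₂ refl       = ≤-refl

  Dg-injective : Injective _≡_ _≡_ Dg
  Dg-injective {c} {c'} Dg≡Dg with classify c | classify c'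
  ... | inj₁ (_ , refl) | inj₁ (_ , refl) = cong (Df e) (ι-injective Dg≡Dg)
  ... | inj₁ (_ , refl) | inj₂ refl       = ⊥-elim (ι≢gap Dg≡Dg)
  ... | inj₂ refl       | inj₁ (_ , refl) = ⊥-elim (ι≢gap (sym Dg≡Dg))
  ... | inj₂ refl       | inj₂ refl       = refl

  g-dist : ∀ y y' → d (F₀ X) (f (η X) (preimage y)) (f (η X) (preimage y')) ≡ Dg (d Y y y')
  g-dist y y' = begin
    d (F₀ X) (f (η X) (preimage y)) (f (η X) (preimage y')) ≡⟨ f-dist (η X) _ _ ⟩
    ι (d X (preimage y) (preimage y'))                      ≡⟨ Dg-Df _ ⟨
    Dg (Df e (d X (preimage y) (preimage y')))              ≡⟨ cong Dg (f-dist e _ _) ⟨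
    Dg (d Y (f e (preimage y)) (f e (preimage y')))         ≡⟨ cong₂ (λ z z' → Dg (d Y z z'))
                                                                      (f∘preimage y) (f∘preimage y') ⟩
    Dg (d Y y y')                                           ∎
    where open ≡-Reasoning

  extension : Σ (DcEmb Y (F₀ X)) λ g → (g ∘E e) ≈ η X
  extension = g , (λ x → cong (f (η X)) (f-inj e (f∘preimage (f e x)))) , Dg-Df
    where
      g : DcEmb Y (F₀ X)
      g = mkDcEmb (f (η X) ∘ preimage) Dg Dg-mono Dg-injective
                  (trans (cong Dg (sym (Df-0 e))) (Dg-Df _)) g-dist

module NewPoint {X Y : UltSpace} (e : DcEmb X Y)
  (onto-distances : Surjective _≡_ _≡_ (Df e)) (new : ExactlyOneNew (f e)) where
  private
    module DY = LinOrd (D Y)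
    open LinOrd (D X)
    open Heights X using (ρ; δ-≢)
    open Gapped (D X) using (ι; ι-mono; ι-injective)
    open Finite (finPt X) using (enumerate; ∈-enumerate)

    y₀ : Pt Y
    y₀ = proj₁ new

    y₀-new : ¬ ∃ λ x → f e x ≡ y₀
    y₀-new = proj₁ (proj₂ new)

  Df⁻¹ : Dist Y → Dist X
  Df⁻¹ c = proj₁ (onto-distances c)

  Df∘Df⁻¹ : ∀ c → Df e (Df⁻¹ c) ≡ c
  Df∘Df⁻¹ c = proj₂ (onto-distances c) refl

  Df⁻¹-mono : ∀ c c' → c DY.≤ c' → Df⁻¹ c ≤ Df⁻¹ c'
  Df⁻¹-mono c c' c≤c' = Df-refl e _ _ (subst₂ DY._≤_ (sym (Df∘Df⁻¹ c)) (sym (Df∘Df⁻¹ c')) c≤c')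

  Df⁻¹-injective : Injective _≡_ _≡_ Df⁻¹
  Df⁻¹-injective {c} {c'} eq = trans (sym (Df∘Df⁻¹ c)) (trans (cong (Df e) eq) (Df∘Df⁻¹ c'))

  k : Pt X → Dist X
  k x = Df⁻¹ (d Y (f e x) y₀)

  Df-k : ∀ x → Df e (k x) ≡ d Y (f e x) y₀
  Df-k x = Df∘Df⁻¹ _

  k-positive : ∀ x → k x ≢ 𝟘
  k-positive x kx≡𝟘 = y₀-new (x , d-zero Y _ _ (begin
    d Y (f e x) y₀ ≡⟨ Df-k x ⟨
    Df e (k x)     ≡⟨ cong (Df e) kx≡𝟘 ⟩
    Df e 𝟘         ≡⟨ Df-0 e ⟩
    0D Y           ∎))
    where open ≡-Reasoning

  pull-⊔ : ∀ {a b c} → Df e a DY.≤ Df e b DY.⊔ Df e c → a ≤ b ⊔ c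
  pull-⊔ {a} {b} {c} le =
    Df-refl e a (b ⊔ c) (subst (Df e a DY.≤_) (sym (mono⇒distrib-⊔ {D X} {D Y} (Df-mono e) b c)) le)

  d≤k⊔k : ∀ x x₀ → d X x x₀ ≤ k x ⊔ k x₀
  d≤k⊔k x x₀ = pull-⊔ (begin
    Df e (d X x x₀)                     ≡⟨ f-dist e x x₀ ⟨
    d Y (f e x) (f e x₀)                ≤⟨ d-ultra-⊔ Y _ y₀ _ ⟩
    d Y (f e x) y₀ DY.⊔ d Y y₀ (f e x₀) ≡⟨ cong₂ DY._⊔_ (Df-k x) (trans (Df-k x₀) (d-sym Y _ _)) ⟨
    Df e (k x) DY.⊔ Df e (k x₀)         ∎)
    where open DY.≤-Reasoning

  k≤d⊔k : ∀ x x₀ → k x ≤ d X x x₀ ⊔ k x₀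
  k≤d⊔k x x₀ = pull-⊔ (begin
    Df e (k x)                                ≡⟨ Df-k x ⟩
    d Y (f e x) y₀                            ≤⟨ d-ultra-⊔ Y _ (f e x₀) _ ⟩
    d Y (f e x) (f e x₀) DY.⊔ d Y (f e x₀) y₀ ≡⟨ cong₂ DY._⊔_ (f-dist e x x₀) (sym (Df-k x₀)) ⟩
    Df e (d X x x₀) DY.⊔ Df e (k x₀)          ∎)
    where open DY.≤-Reasoning

  ρ-apex : ∀ x x₀ → k x₀ ≤ k x → ρ (x , 𝟘) (x₀ , k x₀) ≡ k x
  ρ-apex x x₀ kx₀≤kx = begin
    𝟘 ⊔ k x₀ ⊔ d X x x₀ ≡⟨ cong (_⊔ d X x x₀) (𝟘⊔a≡a (k x₀)) ⟩
    k x₀ ⊔ d X x x₀     ≡⟨ antisym (⊔-lub kx₀≤kx d≤kx) kx≤ ⟩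
    k x                 ∎
    where
      open ≡-Reasoning
      d≤kx : d X x x₀ ≤ k x
      d≤kx = subst (d X x x₀ ≤_) (x≤y⇒y⊔x≈y kx₀≤kx) (d≤k⊔k x x₀)
      kx≤ : k x ≤ k x₀ ⊔ d X x x₀
      kx≤ = subst (k x ≤_) (⊔-comm _ _) (k≤d⊔k x x₀)

  apex : List (Pt X) → Pt (F₀ X)
  apex []       = ∙
  apex (x ∷ xs) = let x₀ = argmin k x xs in [ x₀ , k x₀ ]

  d-apex : ∀ {x xs} → x ∈ xs → d (F₀ X) (f (η X) x) (apex xs) ≡ ι (k x)
  d-apex {x} {x' ∷ xs} x∈ = cong ι (trans (δ-≢ x₀-above) (ρ-apex x x₀ (argmin-minimal k x∈)))
    where
      x₀ = argmin k x' xs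
      x₀-above : (x , 𝟘) ≢ (x₀ , k x₀)
      x₀-above eq = k-positive x₀ (sym (cong proj₂ eq))

  classify : ∀ y → (∃ λ x → f e x ≡ y) ⊎ y ≡ y₀
  classify = Finite.image-or-new (finPt X) (Finite._≟_ (finPt Y)) new

  g : Pt Y → Pt (F₀ X)
  g y with classify y
  ... | inj₁ (x , _) = f (η X) x
  ... | inj₂ _       = apex enumerate

  g-old : ∀ x → g (f e x) ≡ f (η X) x
  g-old x with classify (f e x)
  ... | inj₁ (_ , fx'≡fx) = cong (f (η X)) (f-inj e fx'≡fx)
  ... | inj₂ fx≡y₀        = ⊥-elim (y₀-new (x , fx≡y₀))

  Dg : Dist Y → Dist (F₀ X)
  Dg = ι ∘ Df⁻¹

  Dg-Df : ∀ a → Dg (Df e a) ≡ ι a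
  Dg-Df a = cong ι (Df-inj e (Df∘Df⁻¹ (Df e a)))

  Dg-𝟘 : Dg (0D Y) ≡ ι 𝟘
  Dg-𝟘 = trans (cong Dg (sym (Df-0 e))) (Dg-Df 𝟘)

  g-dist : ∀ y y' → d (F₀ X) (g y) (g y') ≡ Dg (d Y y y')
  g-dist y y' with classify y | classify y'
  ... | inj₁ (x , refl) | inj₁ (x' , refl) =
    trans (f-dist (η X) x x') (sym (trans (cong Dg (f-dist e x x')) (Dg-Df _)))
  ... | inj₁ (x , refl) | inj₂ refl        = d-apex (∈-enumerate x)
  ... | inj₂ refl       | inj₁ (x' , refl) =
    trans (d-sym (F₀ X) _ _) (trans (d-apex (∈-enumerate x')) (cong Dg (d-sym Y _ _)))
  ... | inj₂ refl       | inj₂ refl        =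
    trans (d-refl (F₀ X) _) (sym (trans (cong Dg (d-refl Y y₀)) Dg-𝟘))

  extension : Σ (DcEmb Y (F₀ X)) λ g → (g ∘E e) ≈ η X
  extension =
    mkDcEmb g Dg (λ c c' → ι-mono _ _ ∘ Df⁻¹-mono c c') (Df⁻¹-injective ∘ ι-injective) Dg-𝟘 g-dist ,
    g-old , Dg-Df

proposition4p12 : KatetovFunctor
proposition4p12 = record
  { functor = functor
  ; η = η
  ; η-natural = η-natural
  ; katetov = λ where
      e (inj₁ (onto-points , new))    → NewDistance.extension e onto-points new
      e (inj₂ (onto-distances , new)) → NewPoint.extension e onto-distances new
  }
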